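{- Let $G$ be a finite nonabelian simple group, $x\in G$ an involution and $\alpha=\sigma_x$. Let $g\in G$ and $\gamma\in\mathrm{Aut}(G)$ with $\gamma\alpha=\alpha\gamma$, and for $c\in G$ put $c^{(g,\gamma)}:=\alpha(g)\gamma(c)g^{ -1}$. Then for all $a,b\in G$, $$\{b,\alpha(b^{ -1})\}=\{a^{(g,\gamma)},(\alpha(a^{ -1}))^{(g,\gamma)}\}$$ if and only if the automorphism $\sigma_g\gamma$ maps the set $\{xa,a^{ -1}x\}$ onto the set $\{xb,b^{ -1}x\}$.
   Context: For $h\in G$, $\sigma_h\in\mathrm{Inn}(G)$ denotes conjugation $y\mapsto hyh^{ -1}$; thus $\sigma_x(y)=xyx$ for an involution $x$. $\sigma_g\gamma$ denotes the composite $y\mapsto g\gamma(y)g^{ -1}$. -}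

module Defs where

open import Level using (Level; _⊔_)
open import Data.Nat using (ℕ)
open import Data.Fin using (Fin)
open import Data.Product using (Σ; _×_; ∃)
open import Data.Sum using (_⊎_)
open import Relation.Nullary using (¬_)
open import Relation.Unary using (Pred)
open import Algebra.Bundles using (Group)
open import Algebra.Morphism.Structures using (module GroupMorphisms)

module _ {c ℓ : Level} (G : Group c ℓ) where
  open Group G

  IsFiniteGroup : Set (c ⊔ ℓ)
  IsFiniteGroup = Σ ℕ λ n → Σ (Fin n → Carrier) λ e → ∀ g → ∃ λ i → e i ≈ g

  IsNonabelian : Set (c ⊔ ℓ)
  IsNonabelian = ∃ λ a → ∃ λ b → ¬ (a ∙ b ≈ b ∙ a)

  record IsNormalSubgroup (N : Pred Carrier (c ⊔ ℓ)) : Set (c ⊔ ℓ) where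
    field
      resp     : ∀ {a b} → a ≈ b → N a → N b
      has-ε    : N ε
      closed-∙ : ∀ {a b} → N a → N b → N (a ∙ b)
      closed-⁻¹ : ∀ {a} → N a → N (a ⁻¹)
      closed-conj : ∀ g {a} → N a → N (g ∙ a ∙ g ⁻¹)

  IsSimple : Set (Level.suc (c ⊔ ℓ))
  IsSimple = (∃ λ g → ¬ (g ≈ ε)) ×
    (∀ (N : Pred Carrier (c ⊔ ℓ)) → IsNormalSubgroup N →
       (∀ g → N g → g ≈ ε) ⊎ (∀ g → N g))

  IsFiniteNonabelianSimple : Set (Level.suc (c ⊔ ℓ))
  IsFiniteNonabelianSimple = IsFiniteGroup × IsNonabelian × IsSimple

  IsInvolution : Carrier → Set ℓ
  IsInvolution x = (x ∙ x ≈ ε) × ¬ (x ≈ ε)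

  IsAutomorphism : (Carrier → Carrier) → Set (c ⊔ ℓ)
  IsAutomorphism = GroupMorphisms.IsGroupIsomorphism rawGroup rawGroup

  σ : Carrier → Carrier → Carrier
  σ h y = h ∙ y ∙ h ⁻¹

  σ∘ : Carrier → (Carrier → Carrier) → Carrier → Carrier
  σ∘ g γ y = σ g (γ y)

  twist : (α : Carrier → Carrier) → Carrier → (Carrier → Carrier) → Carrier → Carrier
  twist α g γ c = α g ∙ γ c ∙ g ⁻¹

  PairSetEq : Carrier → Carrier → Carrier → Carrier → Set (c ⊔ ℓ)
  PairSetEq p q r s = ∀ z → ((z ≈ p ⊎ z ≈ q) → (z ≈ r ⊎ z ≈ s))
                          × ((z ≈ r ⊎ z ≈ s) → (z ≈ p ⊎ z ≈ q))

module Submission where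

-- Write α = σ_x, T c = c^(g,γ) = α(g) γ(c) g⁻¹ and φ = σ_g γ.
-- Since x is an involution, left multiplication by x turns the left-hand
-- pair {b, α(b⁻¹)} into {xb, b⁻¹x} and the twisted pair {T a, T(α(a⁻¹))}
-- into {φ(xa), φ(a⁻¹x)}; as left multiplication is a bijection of G, the
-- two pair-set equalities are then equivalent.
--
-- The only point where simplicity enters is the identity γ(x) = x used in
-- computing x · T c.  It holds because γ commutes with σ_x, so that
-- σ_{γ(x)} = γ σ_x γ⁻¹ = σ_x; hence x⁻¹γ(x) is central, and the centre of a
-- nonabelian simple group is trivial.

open import Defs
open import Level using (Level; _⊔_)
open import Data.Product using (_,_; proj₁; proj₂)
open import Data.Sum as Sum using (_⊎_; inj₁; inj₂)
open import Data.Empty using (⊥-elim)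
open import Function using (_∘_)
open import Function.Bundles using (_⇔_; mk⇔)
import Function.Properties.Equivalence as ⇔
open import Relation.Unary using (Pred)
open import Algebra.Bundles using (Group)
open import Algebra.Morphism.Structures using (module GroupMorphisms)
import Algebra.Properties.Group as GroupProperties
import Relation.Binary.Reasoning.Setoid as SetoidReasoning

module GroupFacts {c ℓ : Level} (G : Group c ℓ) where
  open Group G
  open GroupProperties G
  open SetoidReasoning setoid

  σ-cong : ∀ h {y z} → y ≈ z → σ G h y ≈ σ G h z
  σ-cong h = ∙-congʳ ∘ ∙-congˡ

  pairSetEq-resp : ∀ {p q r s p′ q′ r′ s′} →
    p ≈ p′ → q ≈ q′ → r ≈ r′ → s ≈ s′ →
    PairSetEq G p q r s → PairSetEq G p′ q′ r′ s′
  pairSetEq-resp p≈ q≈ r≈ s≈ H z =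
      Sum.map (λ e → trans e r≈) (λ e → trans e s≈)
    ∘ proj₁ (H z)
    ∘ Sum.map (λ e → trans e (sym p≈)) (λ e → trans e (sym q≈))
    , Sum.map (λ e → trans e p≈) (λ e → trans e q≈)
    ∘ proj₂ (H z)
    ∘ Sum.map (λ e → trans e (sym r≈)) (λ e → trans e (sym s≈))

  pairSetEq-cong : ∀ {p q r s p′ q′ r′ s′} →
    p ≈ p′ → q ≈ q′ → r ≈ r′ → s ≈ s′ →
    PairSetEq G p q r s ⇔ PairSetEq G p′ q′ r′ s′
  pairSetEq-cong p≈ q≈ r≈ s≈ = mk⇔
    (pairSetEq-resp p≈ q≈ r≈ s≈)
    (pairSetEq-resp (sym p≈) (sym q≈) (sym r≈) (sym s≈))

  pairSetEq-sym : ∀ {p q r s} → PairSetEq G p q r s ⇔ PairSetEq G r s p q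
  pairSetEq-sym = mk⇔ (λ H z → proj₂ (H z) , proj₁ (H z))
                      (λ H z → proj₂ (H z) , proj₁ (H z))

  pairSetEq-image : (f f⁻ : Carrier → Carrier) →
    (∀ {y z} → y ≈ z → f y ≈ f z) → (∀ {y z} → y ≈ z → f⁻ y ≈ f⁻ z) →
    (∀ y → f⁻ (f y) ≈ y) → (∀ y → f (f⁻ y) ≈ y) →
    ∀ {p q r s} → PairSetEq G p q r s →
    PairSetEq G (f p) (f q) (f r) (f s)
  pairSetEq-image f f⁻ f-cong f⁻-cong f⁻∘f f∘f⁻ H z =
    push ∘ proj₁ (H (f⁻ z)) ∘ pull , push ∘ proj₂ (H (f⁻ z)) ∘ pull
    where
    pull₁ : ∀ {y} → z ≈ f y → f⁻ z ≈ y
    pull₁ e = trans (f⁻-cong e) (f⁻∘f _)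
    push₁ : ∀ {y} → f⁻ z ≈ y → z ≈ f y
    push₁ e = trans (sym (f∘f⁻ z)) (f-cong e)
    pull : ∀ {y y′} → z ≈ f y ⊎ z ≈ f y′ → f⁻ z ≈ y ⊎ f⁻ z ≈ y′
    pull = Sum.map pull₁ pull₁
    push : ∀ {y y′} → f⁻ z ≈ y ⊎ f⁻ z ≈ y′ → z ≈ f y ⊎ z ≈ f y′
    push = Sum.map push₁ push₁

  pairSetEq-leftMul : ∀ h {p q r s} →
    PairSetEq G p q r s ⇔ PairSetEq G (h ∙ p) (h ∙ q) (h ∙ r) (h ∙ s)
  pairSetEq-leftMul h = mk⇔
    (pairSetEq-image (h ∙_) (h ⁻¹ ∙_) ∙-congˡ ∙-congˡ
      (\\-leftDividesʳ h) (\\-leftDividesˡ h))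
    (pairSetEq-resp (\\-leftDividesʳ h _) (\\-leftDividesʳ h _)
                    (\\-leftDividesʳ h _) (\\-leftDividesʳ h _)
     ∘ pairSetEq-image (h ⁻¹ ∙_) (h ∙_) ∙-congˡ ∙-congˡ
         (\\-leftDividesˡ h) (\\-leftDividesʳ h))

  Central : Pred Carrier (c ⊔ ℓ)
  Central a = ∀ z → a ∙ z ≈ z ∙ a

  central-conj : ∀ h {a} → Central a → σ G h a ≈ a
  central-conj h {a} a-central = begin
    h ∙ a ∙ h ⁻¹   ≈⟨ ∙-congʳ (sym (a-central h)) ⟩
    a ∙ h ∙ h ⁻¹   ≈⟨ //-rightDividesʳ h a ⟩
    a              ∎

  centre-normal : IsNormalSubgroup G Central
  centre-normal = record
    { resp = λ a≈b a-central z →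
        trans (∙-congʳ (sym a≈b)) (trans (a-central z) (∙-congˡ a≈b))
    ; has-ε = λ z → trans (identityˡ z) (sym (identityʳ z))
    ; closed-∙ = λ {a} {b} a-central b-central z → begin
        a ∙ b ∙ z     ≈⟨ assoc a b z ⟩
        a ∙ (b ∙ z)   ≈⟨ ∙-congˡ (b-central z) ⟩
        a ∙ (z ∙ b)   ≈⟨ sym (assoc a z b) ⟩
        a ∙ z ∙ b     ≈⟨ ∙-congʳ (a-central z) ⟩
        z ∙ a ∙ b     ≈⟨ assoc z a b ⟩
        z ∙ (a ∙ b)   ∎
    ; closed-⁻¹ = λ {a} a-central z → begin
        a ⁻¹ ∙ z            ≈⟨ ∙-congˡ (sym (⁻¹-involutive z)) ⟩
        a ⁻¹ ∙ z ⁻¹ ⁻¹      ≈⟨ sym (⁻¹-anti-homo-∙ (z ⁻¹) a) ⟩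
        (z ⁻¹ ∙ a) ⁻¹       ≈⟨ ⁻¹-cong (sym (a-central (z ⁻¹))) ⟩
        (a ∙ z ⁻¹) ⁻¹       ≈⟨ ⁻¹-anti-homo-∙ a (z ⁻¹) ⟩
        z ⁻¹ ⁻¹ ∙ a ⁻¹      ≈⟨ ∙-congʳ (⁻¹-involutive z) ⟩
        z ∙ a ⁻¹            ∎
    ; closed-conj = λ h a-central z →
        let e = central-conj h a-central
        in trans (∙-congʳ e) (trans (a-central z) (∙-congˡ (sym e)))
    }

  -- A nonabelian simple group has trivial centre: the centre is normal and
  -- cannot be everything.
  centre-trivial : IsNonabelian G → IsSimple G → ∀ a → Central a → a ≈ ε
  centre-trivial (u , v , uv≉vu) (_ , simple) a with simple Central centre-normal
  ... | inj₁ trivial  = trivial a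
  ... | inj₂ everything = ⊥-elim (uv≉vu (everything u v))

  equal-conj⇒central : ∀ u v → (∀ y → σ G u y ≈ σ G v y) → Central (v ⁻¹ ∙ u)
  equal-conj⇒central u v σu≈σv z = begin
    v ⁻¹ ∙ u ∙ z                   ≈⟨ assoc (v ⁻¹) u z ⟩
    v ⁻¹ ∙ (u ∙ z)                 ≈⟨ ∙-congˡ (sym (//-rightDividesˡ u (u ∙ z))) ⟩
    v ⁻¹ ∙ (σ G u z ∙ u)           ≈⟨ ∙-congˡ (∙-congʳ (σu≈σv z)) ⟩
    v ⁻¹ ∙ (v ∙ z ∙ v ⁻¹ ∙ u)      ≈⟨ ∙-congˡ (assoc (v ∙ z) (v ⁻¹) u) ⟩
    v ⁻¹ ∙ (v ∙ z ∙ (v ⁻¹ ∙ u))    ≈⟨ sym (assoc (v ⁻¹) (v ∙ z) (v ⁻¹ ∙ u)) ⟩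
    v ⁻¹ ∙ (v ∙ z) ∙ (v ⁻¹ ∙ u)    ≈⟨ ∙-congʳ (\\-leftDividesʳ v z) ⟩
    z ∙ (v ⁻¹ ∙ u)                 ∎

  conj-faithful : (∀ a → Central a → a ≈ ε) →
    ∀ u v → (∀ y → σ G u y ≈ σ G v y) → u ≈ v
  conj-faithful centreless u v σu≈σv = sym (⁻¹-injective
    (inverseˡ-unique (v ⁻¹) u (centreless _ (equal-conj⇒central u v σu≈σv))))

  -- An automorphism of a centreless group commuting with σ_x fixes x,
  -- because it conjugates σ_x into σ_{γ(x)}.
  automorphism-fixes : (∀ a → Central a → a ≈ ε) →
    ∀ x γ → IsAutomorphism G γ → (∀ y → γ (σ G x y) ≈ σ G x (γ y)) → γ x ≈ x
  automorphism-fixes centreless x γ γ-aut γσ≈σγ =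
    conj-faithful centreless (γ x) x σγx≈σx
    where
    open GroupMorphisms.IsGroupIsomorphism γ-aut
    σγx≈σx : ∀ z → σ G (γ x) z ≈ σ G x z
    σγx≈σx z with surjective z
    ... | y , γy≈z = begin
      γ x ∙ z ∙ γ x ⁻¹         ≈⟨ ∙-cong (∙-congˡ (sym (γy≈z refl))) (sym (⁻¹-homo x)) ⟩
      γ x ∙ γ y ∙ γ (x ⁻¹)     ≈⟨ ∙-congʳ (sym (∙-homo x y)) ⟩
      γ (x ∙ y) ∙ γ (x ⁻¹)     ≈⟨ sym (∙-homo (x ∙ y) (x ⁻¹)) ⟩
      γ (σ G x y)              ≈⟨ γσ≈σγ y ⟩
      σ G x (γ y)              ≈⟨ σ-cong x (γy≈z refl) ⟩
      σ G x z                  ∎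

  module Twist (x : Carrier) (x²≈ε : x ∙ x ≈ ε) (g : Carrier)
    (γ : Carrier → Carrier)
    (γ-hom : GroupMorphisms.IsGroupHomomorphism rawGroup rawGroup γ)
    (γx≈x : γ x ≈ x) (γσ≈σγ : ∀ y → γ (σ G x y) ≈ σ G x (γ y)) where
    open GroupMorphisms.IsGroupHomomorphism γ-hom using () renaming (homo to ∙-homo)

    T : Carrier → Carrier
    T = twist G (σ G x) g γ

    x⁻¹≈x : x ⁻¹ ≈ x
    x⁻¹≈x = sym (inverseˡ-unique x x x²≈ε)

    involution-shift : ∀ y → x ∙ σ G x y ≈ y ∙ x
    involution-shift y = begin
      x ∙ (x ∙ y ∙ x ⁻¹)   ≈⟨ sym (assoc x (x ∙ y) (x ⁻¹)) ⟩
      x ∙ (x ∙ y) ∙ x ⁻¹   ≈⟨ ∙-congʳ (sym (assoc x x y)) ⟩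
      x ∙ x ∙ y ∙ x ⁻¹     ≈⟨ ∙-congʳ (∙-congʳ x²≈ε) ⟩
      ε ∙ y ∙ x ⁻¹         ≈⟨ ∙-cong (identityˡ y) x⁻¹≈x ⟩
      y ∙ x                ∎

    x∙twist : ∀ c → x ∙ T c ≈ σ G g (x ∙ γ c)
    x∙twist c = begin
      x ∙ (σ G x g ∙ γ c ∙ g ⁻¹)   ≈⟨ sym (assoc x (σ G x g ∙ γ c) (g ⁻¹)) ⟩
      x ∙ (σ G x g ∙ γ c) ∙ g ⁻¹   ≈⟨ ∙-congʳ (sym (assoc x (σ G x g) (γ c))) ⟩
      x ∙ σ G x g ∙ γ c ∙ g ⁻¹     ≈⟨ ∙-congʳ (∙-congʳ (involution-shift g)) ⟩
      g ∙ x ∙ γ c ∙ g ⁻¹           ≈⟨ ∙-congʳ (assoc g x (γ c)) ⟩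
      g ∙ (x ∙ γ c) ∙ g ⁻¹         ∎

    twist-left : ∀ c → x ∙ T c ≈ σ∘ G g γ (x ∙ c)
    twist-left c = begin
      x ∙ T c                  ≈⟨ x∙twist c ⟩
      σ G g (x ∙ γ c)          ≈⟨ σ-cong g (∙-congʳ (sym γx≈x)) ⟩
      σ G g (γ x ∙ γ c)        ≈⟨ σ-cong g (sym (∙-homo x c)) ⟩
      σ G g (γ (x ∙ c))        ∎

    twist-right : ∀ c → x ∙ T (σ G x c) ≈ σ∘ G g γ (c ∙ x)
    twist-right c = begin
      x ∙ T (σ G x c)          ≈⟨ x∙twist (σ G x c) ⟩
      σ G g (x ∙ γ (σ G x c))  ≈⟨ σ-cong g (∙-congˡ (γσ≈σγ c)) ⟩
      σ G g (x ∙ σ G x (γ c))  ≈⟨ σ-cong g (involution-shift (γ c)) ⟩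
      σ G g (γ c ∙ x)          ≈⟨ σ-cong g (∙-congˡ (sym γx≈x)) ⟩
      σ G g (γ c ∙ γ x)        ≈⟨ σ-cong g (sym (∙-homo c x)) ⟩
      σ G g (γ (c ∙ x))        ∎

-- Theorem 2.7.  Multiplying both pair sets on the left by x turns the first
-- equality into {xb, b⁻¹x} = {σ_g γ(xa), σ_g γ(a⁻¹x)}, i.e. the second one.
theorem2p7 : ∀ {c ℓ : Level} (G : Group c ℓ) → IsFiniteNonabelianSimple G →
    (x : Group.Carrier G) → IsInvolution G x →
    (g : Group.Carrier G) (γ : Group.Carrier G → Group.Carrier G) → IsAutomorphism G γ →
    (∀ y → Group._≈_ G (γ (σ G x y)) (σ G x (γ y))) →
    ∀ a b →
      PairSetEq G b (σ G x (Group._⁻¹ G b))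
        (twist G (σ G x) g γ a) (twist G (σ G x) g γ (σ G x (Group._⁻¹ G a)))
      ⇔ PairSetEq G (σ∘ G g γ (Group._∙_ G x a)) (σ∘ G g γ (Group._∙_ G (Group._⁻¹ G a) x))
          (Group._∙_ G x b) (Group._∙_ G (Group._⁻¹ G b) x)
theorem2p7 G (_ , nonabelian , simple) x (x²≈ε , _) g γ γ-aut γσ≈σγ a b =
  ⇔.trans (pairSetEq-leftMul x)
  (⇔.trans (pairSetEq-cong refl (involution-shift (b ⁻¹))
                           (twist-left a) (twist-right (a ⁻¹)))
           pairSetEq-sym)
  where
  open Group G
  open GroupFacts G
  γx≈x : γ x ≈ x
  γx≈x = automorphism-fixes (centre-trivial nonabelian simple) x γ γ-aut γσ≈σγ
  open Twist x x²≈ε g γ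
    (GroupMorphisms.IsGroupIsomorphism.isGroupHomomorphism γ-aut) γx≈x γσ≈σγ
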